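{- Let $\pi\in\mathcal{S}_d$, let $[d]$ be partitioned into groups $G_1,\dots,G_g$, let $\bar{\alpha},\bar{\beta}\in[0,1]^g$ and $k\in[d]$, and suppose at least one $(\bar{\alpha},\bar{\beta})$-$k$-fair ranking exists. Then under the Kendall tau distance there exists a closest $(\bar{\alpha},\bar{\beta})$-$k$-fair ranking $\pi^*$ to $\pi$ (i.e., one minimizing $\mathcal{K}(\pi,\pi^*)$ among all $(\bar{\alpha},\bar{\beta})$-$k$-fair rankings) such that for every $i\in[g]$ and all $a\neq b\in G_i$, $a<_{\pi^*}b$ if and only if $a<_\pi b$.
   Context: $\mathcal{S}_d$ is the set of rankings (permutations) of $[d]$; $x<_\pi y$ means $x$ appears before $y$ in $\pi$. Kendall tau distance: $\mathcal{K}(\pi_1,\pi_2)=|\{(a,b): a<_{\pi_1}b,\ b<_{\pi_2}a\}|$. A ranking is $(\bar{\alpha},\bar{\beta})$-$k$-fair if its first $k$ elements $P$ satisfy $\lfloor\alpha_i k\rfloor\le|P\cap G_i|\le\lceil\beta_i k\rceil$ for all $i\in[g]$.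
   Formalization: The parameters $\bar{\alpha},\bar{\beta}$ have rational entries in [0,1]. -}

module Defs where

open import Data.Nat using (ℕ; _<_; _≤_; _<?_)
open import Data.Fin using (Fin; toℕ; _≟_)
import Data.Fin.Properties as FinP
open import Data.Fin.Permutation using (Permutation′; _⟨$⟩ʳ_; _⟨$⟩ˡ_)
open import Data.List using (List; length; filter; allFin; cartesianProduct)
open import Data.Product using (_×_; _,_; proj₁; proj₂)
open import Data.Integer using (ℤ; +_) renaming (_≤_ to _≤ℤ_)
open import Data.Rational using (ℚ; floor; ceiling; _*_) renaming (_≤_ to _≤ℚ_)
import Data.Rational as ℚ
open import Relation.Nullary.Decidable using (_×-dec_)

-- A ranking of [d] (elements Fin d): π ⟨$⟩ʳ j is the element at position j
-- (positions 0..d-1); π ⟨$⟩ˡ x is the position of element x.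
Ranking : ℕ → Set
Ranking d = Permutation′ d

pos : ∀ {d} → Ranking d → Fin d → Fin d
pos π x = π ⟨$⟩ˡ x

_<[_]_ : ∀ {d} → Fin d → Ranking d → Fin d → Set
x <[ π ] y = toℕ (pos π x) < toℕ (pos π y)

<[]-dec : ∀ {d} (x : Fin d) (π : Ranking d) (y : Fin d) → Relation.Nullary.Decidable.Dec (x <[ π ] y)
<[]-dec x π y = toℕ (pos π x) <? toℕ (pos π y)
  where import Relation.Nullary.Decidable

kendall : ∀ {d} → Ranking d → Ranking d → ℕ
kendall {d} π₁ π₂ =
  length (filter (λ p → <[]-dec (proj₁ p) π₁ (proj₂ p) ×-dec <[]-dec (proj₂ p) π₂ (proj₁ p))
                 (cartesianProduct (allFin d) (allFin d)))

-- Groups: a partition of [d] into g groups, given by the group-membership map.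
-- |P ∩ G_i| where P = set of the first k elements of π:
-- number of positions j < k whose element lies in group i.
topCount : ∀ {d g} → (Fin d → Fin g) → Ranking d → ℕ → Fin g → ℕ
topCount {d} grp π k i =
  length (filter (λ j → (toℕ j <? k) ×-dec (grp (π ⟨$⟩ʳ j) ≟ i)) (allFin d))

Fair : ∀ {d g} → (Fin d → Fin g) → (Fin g → ℚ) → (Fin g → ℚ) → ℕ → Ranking d → Set
Fair grp α β k π = ∀ i →
  (floor (α i * ((+ k) ℚ./ 1)) ≤ℤ + topCount grp π k i) ×
  (+ topCount grp π k i ≤ℤ ceiling (β i * ((+ k) ℚ./ 1)))

InUnit : ℚ → Set
InUnit q = (ℚ.0ℚ ≤ℚ q) × (q ≤ℚ ℚ.1ℚ)

{-# OPTIONS --safe #-}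
-- A closest fair ranking exists by descent on the Kendall distance to π, since the finitely many
-- rankings can be searched exhaustively. Suppose it ordered two members a, b of one group
-- opposite to π. Exchanging a and b keeps it fair, as every prefix keeps its group counts, and
-- strictly decreases the distance: the pair {a, b} stops being discordant, pairs avoiding a and b
-- are untouched, and for every other c the discordant pairs among {c, a}, {c, b} do not increase.
-- In indicator form the last point is the rearrangement inequality (A − B)(X − Y) ≥ 0.
module Submission where

open import Defs
open import Level using (Level)
open import Data.Nat using (ℕ; zero; suc; _+_; _*_; _≤_; _<_; _<?_; z≤n)
open import Data.Nat.Properties
  using (≤-reflexive; ≤-trans; +-mono-≤; +-mono-<; +-mono-<-≤; +-mono-≤-<; +-comm; *-zeroʳ; <⇒≤; <⇒≱; ≮⇒≥; ≰⇒>; ≤∧≢⇒<; m≤m+n; m≤n⇒∃[o]m+o≡n; <-trans; <-irrefl; <-asym; +-0-commutativeMonoid)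
open import Data.Nat.Induction using (<-wellFounded)
open import Data.Nat.Tactic.RingSolver using (solve)
open import Data.Fin using (Fin; zero; suc; toℕ; _≟_)
open import Data.Fin.Properties using (toℕ-injective; all?; any?)
open import Data.Fin.Permutation
  using (Permutation′; _⟨$⟩ʳ_; _⟨$⟩ˡ_; _≈_; permutation; inverseˡ; inverseʳ; transpose; _∘ₚ_)
import Data.Fin.Permutation.Components as PC
import Data.Vec.Functional as Vector
open import Data.List using ([]; _∷_; _++_; length; filter; map; tabulate; allFin; cartesianProduct)
open import Data.List.Properties using (filter-++; filter-≐; length-++; map-tabulate)
open import Data.Product using (∃; _×_; _,_; proj₁; proj₂)
open import Data.Integer using () renaming (_≤?_ to _≤ℤ?_)
open import Data.Rational using (ℚ)
open import Function using (_∘_; id)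
open import Function.Bundles using (_⇔_; mk⇔)
open import Induction.WellFounded using (Acc; acc)
open import Relation.Nullary using (Dec; yes; no; ¬_; contradiction)
open import Relation.Nullary.Decidable using (_×-dec_; map′; dec-true; dec-false; decidable-stable)
open import Relation.Unary using (Pred; Decidable)
open import Relation.Binary.PropositionalEquality
  using (_≡_; _≢_; _≗_; refl; sym; trans; cong; cong₂; subst; subst₂; module ≡-Reasoning)
open import Algebra.Properties.CommutativeMonoid.Sum +-0-commutativeMonoid
  using (sum; sum-syntax; sum-cong-≗; ∑-distrib-+; sum-permute)

private
  variable
    ℓ ℓ′ : Level
    A B : Set ℓ
    P : Set ℓ
    Q : Set ℓ′
    d g m n : ℕ

indicator : Dec P → ℕ
indicator (yes _) = 1
indicator (no _)  = 0

indicator-yes : (P? : Dec P) → P → indicator P? ≡ 1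
indicator-yes (yes _) _  = refl
indicator-yes (no ¬p) p = contradiction p ¬p

indicator-no : (P? : Dec P) → ¬ P → indicator P? ≡ 0
indicator-no (yes p) ¬p = contradiction p ¬p
indicator-no (no _)  _  = refl

indicator-× : (P? : Dec P) (Q? : Dec Q) → indicator (P? ×-dec Q?) ≡ indicator P? * indicator Q?
indicator-× (yes _) (yes _) = refl
indicator-× (yes _) (no _)  = refl
indicator-× (no _)  _       = refl

indicator-mono : (P → Q) → (P? : Dec P) (Q? : Dec Q) → indicator P? ≤ indicator Q?
indicator-mono P⇒Q (yes p) Q? = ≤-reflexive (sym (indicator-yes Q? (P⇒Q p)))
indicator-mono P⇒Q (no _)  Q? = z≤n

m+m≤n+n⇒m≤n : ∀ {m n} → m + m ≤ n + n → m ≤ n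
m+m≤n+n⇒m≤n m+m≤n+n = ≮⇒≥ (λ n<m → <⇒≱ (+-mono-< n<m n<m) m+m≤n+n)

m+m<n+n⇒m<n : ∀ {m n} → m + m < n + n → m < n
m+m<n+n⇒m<n m+m<n+n = ≰⇒> (λ n≤m → <⇒≱ m+m<n+n (+-mono-≤ n≤m n≤m))

-- (a − b)(x − y) ≥ 0, without subtraction
rearrangement : ∀ {a b x y} → b ≤ a → y ≤ x → b * x + a * y ≤ b * y + a * x
rearrangement {b = b} {y = y} b≤a y≤x
  with u , refl ← m≤n⇒∃[o]m+o≡n b≤a | v , refl ← m≤n⇒∃[o]m+o≡n y≤x =
  subst (b * (y + v) + (b + u) * y ≤_) identity (m≤m+n _ (u * v))
  where
  identity : b * (y + v) + (b + u) * y + u * v ≡ b * y + (b + u) * (y + v)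
  identity = solve (b ∷ u ∷ y ∷ v ∷ [])

sum-mono-≤ : {f g : Fin n → ℕ} → (∀ i → f i ≤ g i) → sum f ≤ sum g
sum-mono-≤ {zero}  f≤g = z≤n
sum-mono-≤ {suc n} f≤g = +-mono-≤ (f≤g zero) (sum-mono-≤ (f≤g ∘ suc))

sum-mono-< : {f g : Fin n → ℕ} → (∀ i → f i ≤ g i) → ∀ j → f j < g j → sum f < sum g
sum-mono-< f≤g zero    fj<gj = +-mono-<-≤ fj<gj (sum-mono-≤ (f≤g ∘ suc))
sum-mono-< f≤g (suc j) fj<gj = +-mono-≤-< (f≤g zero) (sum-mono-< (f≤g ∘ suc) j fj<gj)

sum-+-permute : (f : Fin n → ℕ) (ρ : Permutation′ n) →
                sum f + sum f ≡ sum (λ i → f i + f (ρ ⟨$⟩ʳ i))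
sum-+-permute f ρ = trans (cong (sum f +_) (sum-permute f ρ)) (sym (∑-distrib-+ f (f ∘ (ρ ⟨$⟩ʳ_))))

module _ {f g : Fin n → ℕ} (ρ : Permutation′ n) where

  sum-≤-pairing : (∀ i → f i + f (ρ ⟨$⟩ʳ i) ≤ g i + g (ρ ⟨$⟩ʳ i)) → sum f ≤ sum g
  sum-≤-pairing f≤g = m+m≤n+n⇒m≤n
    (subst₂ _≤_ (sym (sum-+-permute f ρ)) (sym (sum-+-permute g ρ)) (sum-mono-≤ f≤g))

  sum-<-pairing : (∀ i → f i + f (ρ ⟨$⟩ʳ i) ≤ g i + g (ρ ⟨$⟩ʳ i)) →
                  ∀ j → f j + f (ρ ⟨$⟩ʳ j) < g j + g (ρ ⟨$⟩ʳ j) → sum f < sum g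
  sum-<-pairing f≤g j fj<gj = m+m<n+n⇒m<n
    (subst₂ _<_ (sym (sum-+-permute f ρ)) (sym (sum-+-permute g ρ)) (sum-mono-< f≤g j fj<gj))

data InPair (i j : Fin n) : Fin n → Set where
  first   : InPair i j i
  second  : InPair i j j
  neither : ∀ {k} → k ≢ i → k ≢ j → InPair i j k

inPair : (i j k : Fin n) → InPair i j k
inPair i j k with k ≟ i | k ≟ j
... | yes refl | _        = first
... | no _     | yes refl = second
... | no k≢i   | no k≢j   = neither k≢i k≢j

module _ (i j : Fin n) where

  transpose-ˡ : PC.transpose i j i ≡ j
  transpose-ˡ rewrite dec-true (i ≟ i) refl = refl

  transpose-ʳ : PC.transpose i j j ≡ i
  transpose-ʳ with j ≟ i
  ... | yes refl = refl
  ... | no _ rewrite dec-true (j ≟ j) refl = refl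

  transpose-fixes : ∀ {k} → k ≢ i → k ≢ j → PC.transpose i j k ≡ k
  transpose-fixes {k} k≢i k≢j rewrite dec-false (k ≟ i) k≢i | dec-false (k ≟ j) k≢j = refl

transpose-preserves : ∀ (f : Fin n → A) {i j} → f i ≡ f j → ∀ k → f (PC.transpose i j k) ≡ f k
transpose-preserves f {i} {j} fi≡fj k with inPair i j k
... | first         = trans (cong f (transpose-ˡ i j)) (sym fi≡fj)
... | second        = trans (cong f (transpose-ʳ i j)) fi≡fj
... | neither k≢i k≢j = cong f (transpose-fixes i j k≢i k≢j)

module _ {f g : Fin n → ℕ} (i j : Fin n) (f≤g : ∀ k → k ≢ i → k ≢ j → f k ≤ g k) where

  private
    paired : f i + f j ≤ g i + g j → ∀ k → f k + f (transpose i j ⟨$⟩ʳ k) ≤ g k + g (transpose i j ⟨$⟩ʳ k)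
    paired fij≤gij k with inPair i j k
    ... | first = subst (λ l → f i + f l ≤ g i + g l) (sym (transpose-ˡ i j)) fij≤gij
    ... | second = subst (λ l → f j + f l ≤ g j + g l) (sym (transpose-ʳ i j))
                         (subst₂ _≤_ (+-comm (f i) (f j)) (+-comm (g i) (g j)) fij≤gij)
    ... | neither k≢i k≢j = subst (λ l → f k + f l ≤ g k + g l) (sym (transpose-fixes i j k≢i k≢j))
                                  (+-mono-≤ (f≤g k k≢i k≢j) (f≤g k k≢i k≢j))

  sum-mono-≤-pair : f i + f j ≤ g i + g j → sum f ≤ sum g
  sum-mono-≤-pair fij≤gij = sum-≤-pairing (transpose i j) (paired fij≤gij)

  sum-mono-<-pair : f i + f j < g i + g j → sum f < sum g
  sum-mono-<-pair fij<gij = sum-<-pairing (transpose i j) (paired (<⇒≤ fij<gij)) i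
    (subst (λ l → f i + f l < g i + g l) (sym (transpose-ˡ i j)) fij<gij)

inversion : (px py sx sy : ℕ) → ℕ
inversion px py sx sy = indicator (px <? py) * indicator (sy <? sx)

discordantPairs : (p s : Fin n → ℕ) → ℕ
discordantPairs {n} p s = ∑[ x < n ] ∑[ y < n ] inversion (p x) (p y) (s x) (s y)

inversion-≮ : ∀ px py sx sy → ¬ px < py → inversion px py sx sy ≡ 0
inversion-≮ px py sx sy px≮py = cong (_* indicator (sy <? sx)) (indicator-no (px <? py) px≮py)

inversion-≯ : ∀ px py sx sy → ¬ sy < sx → inversion px py sx sy ≡ 0
inversion-≯ px py sx sy sy≮sx =
  trans (cong (indicator (px <? py) *_) (indicator-no (sy <? sx) sy≮sx)) (*-zeroʳ (indicator (px <? py)))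

inversion-≡1 : ∀ px py sx sy → px < py → sy < sx → inversion px py sx sy ≡ 1
inversion-≡1 px py sx sy px<py sy<sx =
  cong₂ _*_ (indicator-yes (px <? py) px<py) (indicator-yes (sy <? sx) sy<sx)

exchange-inversionsˡ : ∀ {pa pb sa sb} → pa < pb → sb < sa → ∀ pc sc →
                       inversion pc pa sc sb + inversion pc pb sc sa ≤
                       inversion pc pa sc sa + inversion pc pb sc sb
exchange-inversionsˡ {pa} {pb} {sa} {sb} pa<pb sb<sa pc sc = rearrangement
  (indicator-mono (λ pc<pa → <-trans pc<pa pa<pb) (pc <? pa) (pc <? pb))
  (indicator-mono (<-trans sb<sa) (sa <? sc) (sb <? sc))

exchange-inversionsʳ : ∀ {pa pb sa sb} → pa < pb → sb < sa → ∀ pc sc →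
                       inversion pa pc sb sc + inversion pb pc sa sc ≤
                       inversion pa pc sa sc + inversion pb pc sb sc
exchange-inversionsʳ {pa} {pb} {sa} {sb} pa<pb sb<sa pc sc =
  subst₂ _≤_ (+-comm (bc * ca) (ac * cb)) (+-comm (bc * cb) (ac * ca)) (rearrangement
    (indicator-mono (<-trans pa<pb) (pb <? pc) (pa <? pc))
    (indicator-mono (λ sc<sb → <-trans sc<sb sb<sa) (sc <? sb) (sc <? sa)))
  where
  ac = indicator (pa <? pc)
  bc = indicator (pb <? pc)
  ca = indicator (sc <? sa)
  cb = indicator (sc <? sb)

module _ (p s s′ : Fin n → ℕ) {a b : Fin n} (pa<pb : p a < p b) (sb<sa : s b < s a)
         (s′a≡sb : s′ a ≡ s b) (s′b≡sa : s′ b ≡ s a)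
         (s′c≡sc : ∀ {c} → c ≢ a → c ≢ b → s′ c ≡ s c) where

  private
    inv : (Fin n → ℕ) → Fin n → Fin n → ℕ
    inv t x y = inversion (p x) (p y) (t x) (t y)

    row : (Fin n → ℕ) → Fin n → ℕ
    row t x = sum (inv t x)

    row-other : ∀ c → c ≢ a → c ≢ b → row s′ c ≤ row s c
    row-other c c≢a c≢b = sum-mono-≤-pair a b
      (λ y y≢a y≢b → ≤-reflexive (cong₂ (inversion (p c) (p y)) s′c≡sc′ (s′c≡sc y≢a y≢b)))
      (subst (_≤ inv s c a + inv s c b)
        (sym (cong₂ _+_ (cong₂ (inversion (p c) (p a)) s′c≡sc′ s′a≡sb)
                        (cong₂ (inversion (p c) (p b)) s′c≡sc′ s′b≡sa)))
        (exchange-inversionsˡ pa<pb sb<sa (p c) (s c)))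
      where s′c≡sc′ = s′c≡sc c≢a c≢b

    pair-at-b : inv s′ a b + inv s′ b b < inv s a b + inv s b b
    pair-at-b = subst (_< inv s a b + inv s b b)
      (sym (cong₂ _+_ (trans (cong₂ (inversion (p a) (p b)) s′a≡sb s′b≡sa)
                             (inversion-≯ (p a) (p b) (s b) (s a) (<-asym sb<sa)))
                      (inversion-≮ (p b) (p b) (s′ b) (s′ b) (<-irrefl refl))))
      (≤-trans (≤-reflexive (sym (inversion-≡1 (p a) (p b) (s a) (s b) pa<pb sb<sa))) (m≤m+n _ _))

    pair : ∀ y → inv s′ a y + inv s′ b y ≤ inv s a y + inv s b y
    pair y with inPair a b y
    ... | first = subst (_≤ inv s a a + inv s b a)
      (sym (cong₂ _+_ (inversion-≮ (p a) (p a) (s′ a) (s′ a) (<-irrefl refl))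
                      (inversion-≮ (p b) (p a) (s′ b) (s′ a) (<-asym pa<pb))))
      z≤n
    ... | second = <⇒≤ pair-at-b
    ... | neither y≢a y≢b = subst (_≤ inv s a y + inv s b y)
      (sym (cong₂ _+_ (cong₂ (inversion (p a) (p y)) s′a≡sb s′y≡sy)
                      (cong₂ (inversion (p b) (p y)) s′b≡sa s′y≡sy)))
      (exchange-inversionsʳ pa<pb sb<sa (p y) (s y))
      where s′y≡sy = s′c≡sc y≢a y≢b

    rows-a-b : row s′ a + row s′ b < row s a + row s b
    rows-a-b = subst₂ _<_ (∑-distrib-+ (inv s′ a) (inv s′ b)) (∑-distrib-+ (inv s a) (inv s b))
      (sum-mono-< pair b pair-at-b)

  discordantPairs-exchange : discordantPairs p s′ < discordantPairs p s
  discordantPairs-exchange = sum-mono-<-pair a b row-other rows-a-b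

module _ {p} {P : Pred A p} (P? : Decidable P) where

  count-tabulate : (f : Fin n → A) → length (filter P? (tabulate f)) ≡ sum (λ i → indicator (P? (f i)))
  count-tabulate {zero}  f = refl
  count-tabulate {suc n} f with P? (f zero)
  ... | yes _ = cong suc (count-tabulate (f ∘ suc))
  ... | no _  = count-tabulate (f ∘ suc)

module _ {p} {P : Pred (A × B) p} (P? : Decidable P) where

  count-cartesianProduct : (f : Fin m → A) (g : Fin n → B) →
    length (filter P? (cartesianProduct (tabulate f) (tabulate g))) ≡
    ∑[ i < m ] ∑[ j < n ] indicator (P? (f i , g j))
  count-cartesianProduct {zero}  f g = refl
  count-cartesianProduct {suc m} f g = begin
    length (filter P? (row ++ rest))               ≡⟨ cong length (filter-++ P? row rest) ⟩
    length (filter P? row ++ filter P? rest)       ≡⟨ length-++ (filter P? row) ⟩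
    length (filter P? row) + length (filter P? rest)
      ≡⟨ cong₂ _+_ (trans (cong (length ∘ filter P?) (map-tabulate g (f zero ,_)))
                          (count-tabulate P? (λ j → f zero , g j)))
                   (count-cartesianProduct (f ∘ suc) g) ⟩
    ∑[ i < suc m ] ∑[ j < _ ] indicator (P? (f i , g j)) ∎
    where
    open ≡-Reasoning
    row  = map (f zero ,_) (tabulate g)
    rest = cartesianProduct (tabulate (f ∘ suc)) (tabulate g)

position : Ranking d → Fin d → ℕ
position σ x = toℕ (pos σ x)

kendall≡discordantPairs : (π σ : Ranking d) → kendall π σ ≡ discordantPairs (position π) (position σ)
kendall≡discordantPairs {d} π σ = trans (count-cartesianProduct discordant? (id {A = Fin d}) id)
  (sum-cong-≗ λ x → sum-cong-≗ λ y → indicator-× (<[]-dec x π y) (<[]-dec y σ x))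
  where discordant? = λ (p : Fin d × Fin d) → <[]-dec (proj₁ p) π (proj₂ p) ×-dec <[]-dec (proj₂ p) σ (proj₁ p)

⟨$⟩ˡ-cong : (σ ρ : Ranking d) → σ ≈ ρ → ∀ x → σ ⟨$⟩ˡ x ≡ ρ ⟨$⟩ˡ x
⟨$⟩ˡ-cong σ ρ σ≈ρ x = trans (cong (σ ⟨$⟩ˡ_) (trans (sym (inverseʳ ρ)) (sym (σ≈ρ (ρ ⟨$⟩ˡ x)))))
                                    (inverseˡ σ)

kendall-cong : (π σ ρ : Ranking d) → σ ≈ ρ → kendall π σ ≡ kendall π ρ
kendall-cong π σ ρ σ≈ρ = trans (kendall≡discordantPairs π σ) (trans
  (sum-cong-≗ λ x → sum-cong-≗ λ y → cong₂ (inversion (position π x) (position π y)) (s≡r x) (s≡r y))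
  (sym (kendall≡discordantPairs π ρ)))
  where s≡r = λ x → cong toℕ (⟨$⟩ˡ-cong σ ρ σ≈ρ x)

position-injective : (σ : Ranking d) {x y : Fin d} → position σ x ≡ position σ y → x ≡ y
position-injective σ eq = trans (sym (inverseʳ σ)) (trans (cong (σ ⟨$⟩ʳ_) (toℕ-injective eq)) (inverseʳ σ))

≮[]⇒>[] : (σ : Ranking d) {x y : Fin d} → x ≢ y → ¬ x <[ σ ] y → y <[ σ ] x
≮[]⇒>[] σ x≢y x≮y = ≤∧≢⇒< (≮⇒≥ x≮y) (λ eq → x≢y (position-injective σ (sym eq)))

module _ (grp : Fin d → Fin g) (α β : Fin g → ℚ) (k : ℕ) where

  Fair? : ∀ σ → Dec (Fair grp α β k σ)
  Fair? σ = all? λ i → (_ ≤ℤ? _) ×-dec (_ ≤ℤ? _)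

  topCount-cong : (σ ρ : Ranking d) → (∀ j → grp (σ ⟨$⟩ʳ j) ≡ grp (ρ ⟨$⟩ʳ j)) →
                  ∀ i → topCount grp σ k i ≡ topCount grp ρ k i
  topCount-cong σ ρ same-groups i = cong length (filter-≐ (among σ) (among ρ)
    ( (λ {j} (j<k , σj∈i) → j<k , trans (sym (same-groups j)) σj∈i)
    , (λ {j} (j<k , ρj∈i) → j<k , trans (same-groups j) ρj∈i))
    (allFin d))
    where among = λ (τ : Ranking d) j → (toℕ j <? k) ×-dec (grp (τ ⟨$⟩ʳ j) ≟ i)

  Fair-cong : (σ ρ : Ranking d) → (∀ j → grp (σ ⟨$⟩ʳ j) ≡ grp (ρ ⟨$⟩ʳ j)) →
              Fair grp α β k σ → Fair grp α β k ρ
  Fair-cong σ ρ same-groups fair i rewrite sym (topCount-cong σ ρ same-groups i) = fair i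

  swap-preserves-Fair : (σ : Ranking d) {a b : Fin d} → grp a ≡ grp b →
                        Fair grp α β k σ → Fair grp α β k (σ ∘ₚ transpose a b)
  swap-preserves-Fair σ {a} {b} ga≡gb =
    Fair-cong σ (σ ∘ₚ transpose a b) (λ j → sym (transpose-preserves grp {a} {b} ga≡gb (σ ⟨$⟩ʳ j)))

swap-reduces-kendall : (π σ : Ranking d) {a b : Fin d} → b <[ π ] a → a <[ σ ] b →
                       kendall π (σ ∘ₚ transpose a b) < kendall π σ
swap-reduces-kendall π σ {a} {b} b<a a<b =
  subst₂ _<_ (sym (kendall≡discordantPairs π (σ ∘ₚ transpose a b))) (sym (kendall≡discordantPairs π σ))
    (discordantPairs-exchange (position π) (position σ) (position (σ ∘ₚ transpose a b)) {b} {a} b<a a<b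
      (cong (position σ) (transpose-ˡ b a))
      (cong (position σ) (transpose-ʳ b a))
      (λ c≢b c≢a → cong (position σ) (transpose-fixes b a c≢b c≢a)))

any-function? : ∀ {m} {P : (Fin m → Fin n) → Set ℓ} → (∀ {f h} → f ≗ h → P f → P h) →
                (∀ f → Dec (P f)) → Dec (∃ P)
any-function? {m = zero} resp P? = map′ (_ ,_) (λ (f , Pf) → resp (λ ()) Pf) (P? λ ())
any-function? {m = suc m} resp P? =
  map′ (λ (x , f , Pxf) → x Vector.∷ f , Pxf)
       (λ (f , Pf) → Vector.head f , Vector.tail f , resp (λ { zero → refl ; (suc i) → refl }) Pf)
       (any? λ x → any-function? (λ f≗h → resp λ { zero → refl ; (suc i) → f≗h i }) (P? ∘ (x Vector.∷_)))

module _ {P : Ranking n → Set ℓ} (resp : ∀ {σ ρ} → σ ≈ ρ → P σ → P ρ) (P? : ∀ σ → Dec (P σ)) where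

  private
    HasMaps : (Fin n → Fin n) → (Fin n → Fin n) → Set ℓ
    HasMaps f h = ∃ λ σ → P σ × (σ ⟨$⟩ʳ_) ≗ f × (σ ⟨$⟩ˡ_) ≗ h

    hasMaps? : ∀ f h → Dec (HasMaps f h)
    hasMaps? f h with all? (λ y → f (h y) ≟ y) | all? (λ x → h (f x) ≟ x)
    ... | yes fh | yes hf = map′ (λ Pσ → σ , Pσ , (λ _ → refl) , (λ _ → refl))
                                 (λ (ρ , Pρ , ρʳ≗f , _) → resp ρʳ≗f Pρ) (P? σ)
      where σ = permutation f h fh hf
    ... | no ¬fh | _ = no λ (ρ , _ , ρʳ≗f , ρˡ≗h) → ¬fh λ y →
      trans (sym (ρʳ≗f (h y))) (trans (cong (ρ ⟨$⟩ʳ_) (sym (ρˡ≗h y))) (inverseʳ ρ))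
    ... | yes _ | no ¬hf = no λ (ρ , _ , ρʳ≗f , ρˡ≗h) → ¬hf λ x →
      trans (sym (ρˡ≗h (f x))) (trans (cong (ρ ⟨$⟩ˡ_) (sym (ρʳ≗f x))) (inverseˡ ρ))

  any-ranking? : Dec (∃ P)
  any-ranking? =
    map′ (λ (_ , _ , σ , Pσ , _) → σ , Pσ)
         (λ (σ , Pσ) → _ , _ , σ , Pσ , (λ _ → refl) , (λ _ → refl))
         (any-function? (λ f≗f′ (h , ρ , Pρ , ρʳ≗f , ρˡ≗h) → h , ρ , Pρ , (λ x → trans (ρʳ≗f x) (f≗f′ x)) , ρˡ≗h)
           λ f → any-function? (λ h≗h′ (ρ , Pρ , ρʳ≗f , ρˡ≗h) → ρ , Pρ , ρʳ≗f , λ x → trans (ρˡ≗h x) (h≗h′ x))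
                               (hasMaps? f))

module _ {A : Set ℓ} (f : A → ℕ) {P : A → Set ℓ′}
         (improve? : ∀ x → Dec (∃ λ y → P y × f y < f x)) where

  minimum-by-descent : ∀ x → P x → ∃ λ y → P y × (∀ z → P z → f y ≤ f z)
  minimum-by-descent x = descend x (<-wellFounded (f x))
    where
    descend : ∀ x → Acc _<_ (f x) → P x → ∃ λ y → P y × (∀ z → P z → f y ≤ f z)
    descend x (acc smaller) Px with improve? x
    ... | yes (y , Py , fy<fx) = descend y (smaller fy<fx) Py
    ... | no optimal = x , Px , λ z Pz → ≮⇒≥ λ fz<fx → optimal (z , Pz , fz<fx)

order-agrees : ∀ {A : Set ℓ} (cls : Fin d → A) {ρ τ : Ranking d} →
               (∀ {a b} → cls a ≡ cls b → a <[ ρ ] b → ¬ b <[ τ ] a) →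
               ∀ {a b} → cls a ≡ cls b → a ≢ b → (a <[ ρ ] b ⇔ a <[ τ ] b)
order-agrees cls {ρ} {τ} no-inversion {a} {b} ca≡cb a≢b = mk⇔
  (λ a<ρb → decidable-stable (<[]-dec a τ b) λ a≮τb →
     no-inversion ca≡cb a<ρb (≮[]⇒>[] τ a≢b a≮τb))
  (λ a<τb → decidable-stable (<[]-dec a ρ b) λ a≮ρb →
     no-inversion (sym ca≡cb) (≮[]⇒>[] ρ a≢b a≮ρb) a<τb)

module _ (π : Ranking d) (grp : Fin d → Fin g) (α β : Fin g → ℚ) (k : ℕ) where

  closer? : ∀ σ → Dec (∃ λ ρ → Fair grp α β k ρ × kendall π ρ < kendall π σ)
  closer? σ = any-ranking?
    (λ {ρ} {ρ′} ρ≈ρ′ (fair , closer) → Fair-cong grp α β k ρ ρ′ (λ j → cong grp (ρ≈ρ′ j)) fair ,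
                               subst (_< kendall π σ) (kendall-cong π ρ ρ′ ρ≈ρ′) closer)
    (λ ρ → Fair? grp α β k ρ ×-dec (kendall π ρ <? kendall π σ))

  closest-has-no-group-inversion : ∀ πs → Fair grp α β k πs →
    (∀ σ → Fair grp α β k σ → kendall π πs ≤ kendall π σ) →
    ∀ {a b} → grp a ≡ grp b → a <[ πs ] b → ¬ b <[ π ] a
  closest-has-no-group-inversion πs fair closest {a} {b} ga≡gb a<b b<a =
    <⇒≱ (swap-reduces-kendall π πs b<a a<b)
        (closest (πs ∘ₚ transpose a b) (swap-preserves-Fair grp α β k πs ga≡gb fair))

claim1 : ∀ (d g : ℕ) (π : Ranking d) (grp : Fin d → Fin g) (α β : Fin g → ℚ) (k : ℕ)
           → (∀ i → InUnit (α i)) → (∀ i → InUnit (β i))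
           → 1 ≤ k → k ≤ d
           → (∃ λ σ → Fair grp α β k σ)
           → ∃ λ πs → Fair grp α β k πs
               × (∀ σ → Fair grp α β k σ → kendall π πs ≤ kendall π σ)
               × (∀ a b → grp a ≡ grp b → a ≢ b → (a <[ πs ] b ⇔ a <[ π ] b))
claim1 d g π grp α β k _ _ _ _ (σ₀ , fair₀) =
  let πs , fair , closest = minimum-by-descent (kendall π) {P = Fair grp α β k} (closer? π grp α β k) σ₀ fair₀
  in  πs , fair , closest ,
      λ a b → order-agrees grp {πs} {π} (closest-has-no-group-inversion π grp α β k πs fair closest)
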